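{- Let $k\ge 2$ and $t=(t_1,\dots,t_k)$. Let $F_{k,n}(t)$ and $G_{k,n}(t)$ be the generalized Fibonacci and Lucas polynomials defined in the context. Then for every integer $n\ge 0$, $$G_{k,n}(t)=kF_{k,n}(t)-\sum_{j=2}^{k}(k-j+1)\,t_{j-1}\,F_{k,n+1-j}(t).$$
   Context: $t_1,\dots,t_k$ are indeterminates (or constants in a commutative ring). Generalized Fibonacci polynomials: $F_{k,n}(t)=0$ for $n<0$, $F_{k,0}(t)=1$, and $F_{k,n+1}(t)=t_1F_{k,n}(t)+t_2F_{k,n-1}(t)+\cdots+t_kF_{k,n-k+1}(t)$ for $n\ge 0$. Generalized Lucas polynomials: $G_{k,0}(t)=k$ and, for $n\ge 1$, $G_{k,n}(t)=\sum_{a}\frac{n}{|a|}\binom{|a|}{a_1,\dots,a_k}t_1^{a_1}\cdots t_k^{a_k}$, the sum over all $k$-tuples $a=(a_1,\dots,a_k)$ of nonnegative integers with $\sum_{j=1}^k ja_j=n$, where $|a|=\sum_j a_j$ and $\binom{|a|}{a_1,\dots,a_k}$ is the multinomial coefficient. Equivalently, $G_{k,n}(t)=\operatorname{tr}(A_{(k)}^n)$ where $A_{(k)}$ is the $k\times k$ matrix with ones on the superdiagonal, last row $(t_k,t_{k-1},\dots,t_1)$ and zeros elsewhere (i.e. $G_{k,n}$ is the $n$-th power sum of the roots of $x^k-t_1x^{k-1}-\cdots-t_k$). -}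

module Defs where

open import Level using (Level)
open import Algebra.Bundles using (CommutativeRing)
open import Data.Nat using (ℕ; zero; suc; _<?_)
open import Data.Nat.Properties using (_≟_)
open import Data.Fin using (Fin; toℕ; fromℕ<; opposite)
  renaming (zero to fzero; suc to fsuc)
open import Data.Integer using (ℤ; +_; -[1+_])
open import Relation.Nullary using (yes; no)

module GenFibLuc {c ℓ : Level} (R : CommutativeRing c ℓ) where
  open CommutativeRing R

  sumFin : (n : ℕ) → (Fin n → Carrier) → Carrier
  sumFin zero    f = 0#
  sumFin (suc n) f = f fzero + sumFin n (λ i → f (fsuc i))

  sumFrom : ℕ → ℕ → (ℕ → Carrier) → Carrier
  sumFrom a zero      f = 0#
  sumFrom a (suc len) f = f a + sumFrom (suc a) len f

  -- Σ_{j = a}^{b} f j  (empty when b < a)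
  sumRange : ℕ → ℕ → (ℕ → Carrier) → Carrier
  sumRange a b f = sumFrom a (suc b Data.Nat.∸ a) f

  nat : ℕ → Carrier
  nat zero    = 0#
  nat (suc n) = 1# + nat n

  -- The parameters t = (t_1,…,t_k) are given as  t : Fin k → Carrier,
  -- with  t i = t_{toℕ i + 1}.  tIx t j is t_j (1-based), for 1 ≤ j ≤ k
  -- (and 0 outside that range, which never occurs below).
  tIx : {k : ℕ} → (Fin k → Carrier) → ℕ → Carrier
  tIx {k} t zero    = 0#
  tIx {k} t (suc j) with j <? k
  ... | yes p = t (fromℕ< p)
  ... | no  _ = 0#

  -- hist t n j = F_{k,n-j}(t)  (with F_{k,m} = 0 for m < 0).
  -- This encodes:  F_{k,0} = 1,  F_{k,m} = 0 (m<0),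
  -- F_{k,n+1} = t_1 F_{k,n} + … + t_k F_{k,n-k+1}.
  hist : {k : ℕ} → (Fin k → Carrier) → ℕ → ℕ → Carrier
  hist t zero    zero    = 1#
  hist t zero    (suc j) = 0#
  hist {k} t (suc n) zero = sumFin k (λ i → t i * hist t n (toℕ i))
  hist t (suc n) (suc j) = hist t n j

  F : {k : ℕ} → (Fin k → Carrier) → ℤ → Carrier
  F t (+ n)      = hist t n 0
  F t -[1+ n ]   = 0#

  Mat : ℕ → Set c
  Mat k = Fin k → Fin k → Carrier

  _⊗_ : {k : ℕ} → Mat k → Mat k → Mat k
  _⊗_ {k} A B i j = sumFin k (λ l → A i l * B l j)

  idMat : {k : ℕ} → Mat k
  idMat i j with toℕ i ≟ toℕ j
  ... | yes _ = 1#
  ... | no  _ = 0#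

  _^M_ : {k : ℕ} → Mat k → ℕ → Mat k
  A ^M zero    = idMat
  A ^M (suc n) = A ⊗ (A ^M n)

  trace : {k : ℕ} → Mat k → Carrier
  trace {k} A = sumFin k (λ i → A i i)

  -- Companion matrix A_(k): ones on the superdiagonal, last row
  -- (t_k, t_{k-1}, …, t_1), zeros elsewhere.  Entry (last, j) is
  -- t_{k-j} (0-based column j), i.e.  t (opposite j).
  companion : {k : ℕ} → (Fin k → Carrier) → Mat k
  companion {k} t i j with suc (toℕ i) ≟ k
  ... | yes _ = t (opposite j)
  ... | no  _ with toℕ j ≟ suc (toℕ i)
  ...   | yes _ = 1#
  ...   | no  _ = 0#

  G : {k : ℕ} → (Fin k → Carrier) → ℕ → Carrier
  G t n = trace (companion t ^M n)

-- Write Λ_b u = u_b − Σ_{r=0}^{k-2-b} t_{r+1} u_{b+1+r} for a sequence u.  The (i, j) entry of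
-- A_(k)^n is Λ_j applied to m ↦ F_{k,n+i-m}.  For n = 0 this is the identity matrix: the
-- correction sum vanishes when i ≤ j, and when i > j the recurrence for F_{k,i-j} cancels it.
-- Multiplying by A_(k) on the left moves row i+1 to row i for i < k-1; the last row
-- (t_k, …, t_1) passes through the linear functional Λ_j, and the recurrence turns the resulting
-- combination of shifted sequences into m ↦ F_{k,n+k-m}.  Summing the diagonal gives
--   G_{k,n} = k F_{k,n} − Σ_{a<k} Σ_{r<k-1-a} t_{r+1} F_{k,n-1-r},
-- in which t_{r+1} F_{k,n-1-r} occurs for k-1-r values of a.
module Submission where

open import Defs
open import Level using (Level)
open import Algebra.Bundles using (CommutativeRing)
open import Data.Nat using (ℕ; suc; _≤_; _∸_)
open import Data.Fin using (Fin)
open import Data.Integer using (+_) renaming (_-_ to _-ℤ_)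

open import Data.Nat as ℕ using (zero; _<_; z≤n; s≤s)
import Data.Nat.Properties as ℕₚ
open import Data.Fin using (toℕ; fromℕ<; opposite; punchIn) renaming (zero to fzero; suc to fsuc)
open import Data.Fin.Properties
  using (toℕ<n; toℕ-injective; toℕ-inject₁; toℕ-fromℕ; toℕ-fromℕ<; fromℕ<-toℕ; punchInᵢ≢i;
         opposite-prop; opposite-involutive)
import Data.Fin.Permutation as Perm
open import Data.Integer.Base using (_⊖_)
open import Data.Integer.Properties using (m-n≡m⊖n; [1+m]⊖[1+n]≡m⊖n)
open import Data.Sum using (inj₁; inj₂)
open import Data.Empty using (⊥-elim)
open import Function using (_∘_)
open import Relation.Nullary using (Dec; yes; no)
open import Relation.Binary.PropositionalEquality as ≡ using (_≡_; _≢_; cong)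
open import Relation.Binary.Definitions using (tri<; tri≈; tri>)
import Algebra.Properties.Ring as RingProperties
import Algebra.Properties.Group as GroupProperties
import Algebra.Properties.CommutativeSemigroup as CommutativeSemigroupProperties
import Algebra.Properties.Semiring.Sum as SemiringSum

m<n∸o⇒o+m<n : ∀ {m n o} → m < n ∸ o → o ℕ.+ m < n
m<n∸o⇒o+m<n {n = suc n} {zero}  m<n   = m<n
m<n∸o⇒o+m<n {n = suc n} {suc o} m<n∸o = s≤s (m<n∸o⇒o+m<n m<n∸o)

m∸n≡1+m∸[1+n] : ∀ {m n} → n < m → m ∸ n ≡ suc (m ∸ suc n)
m∸n≡1+m∸[1+n] {suc m} {zero}  _         = ≡.refl
m∸n≡1+m∸[1+n] {suc m} {suc n} (s≤s n<m) = m∸n≡1+m∸[1+n] n<m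

module Sums {c ℓ : Level} (R : CommutativeRing c ℓ) where
  open CommutativeRing R
  open GenFibLuc R using (sumFin; sumFrom; nat)
  open SemiringSum semiring public
    using (sum; sum-cong-≋; sum-cong-≗; sum-replicate-zero; sum-init-last; sum-remove;
           sum-permute; ∑-distrib-+; ∑-comm; *-distribˡ-sum)
  open RingProperties ring using (-1*x≈-x)
  open import Relation.Binary.Reasoning.Setoid setoid

  ∑< : ℕ → (ℕ → Carrier) → Carrier
  ∑< m f = sum {m} (f ∘ toℕ)

  sumFin≡sum : ∀ n (f : Fin n → Carrier) → sumFin n f ≡ sum f
  sumFin≡sum zero    f = ≡.refl
  sumFin≡sum (suc n) f = cong (λ s → f fzero + s) (sumFin≡sum n (f ∘ fsuc))

  sumFrom≈∑< : ∀ a len (f : ℕ → Carrier) → sumFrom a len f ≈ ∑< len (λ r → f (a ℕ.+ r))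
  sumFrom≈∑< a zero      f = refl
  sumFrom≈∑< a (suc len) f = +-cong (reflexive (cong f (≡.sym (ℕₚ.+-identityʳ a))))
    (trans (sumFrom≈∑< (suc a) len f)
           (reflexive (sum-cong-≗ {len} (λ i → cong f (≡.sym (ℕₚ.+-suc a (toℕ i)))))))

  ∑<-cong : ∀ m {f g : ℕ → Carrier} → (∀ r → r < m → f r ≈ g r) → ∑< m f ≈ ∑< m g
  ∑<-cong m f≈g = sum-cong-≋ (λ i → f≈g (toℕ i) (toℕ<n i))

  ∑<-zero : ∀ m {f : ℕ → Carrier} → (∀ r → r < m → f r ≈ 0#) → ∑< m f ≈ 0#
  ∑<-zero m f≈0 = trans (∑<-cong m f≈0) (sum-replicate-zero m)

  ∑<-distrib-- : ∀ m (f g : ℕ → Carrier) → ∑< m (λ r → f r - g r) ≈ ∑< m f - ∑< m g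
  ∑<-distrib-- m f g = begin
    ∑< m (λ r → f r - g r)            ≈⟨ ∑-distrib-+ {m} (f ∘ toℕ) (λ i → - g (toℕ i)) ⟩
    ∑< m f + ∑< m (λ r → - g r)       ≈⟨ +-congˡ (∑<-cong m (λ r _ → sym (-1*x≈-x (g r)))) ⟩
    ∑< m f + ∑< m (λ r → - 1# * g r)  ≈⟨ +-congˡ (*-distribˡ-sum {m} (- 1#) (g ∘ toℕ)) ⟨
    ∑< m f + - 1# * ∑< m g            ≈⟨ +-congˡ (-1*x≈-x (∑< m g)) ⟩
    ∑< m f - ∑< m g                   ∎

  ∑<-snoc : ∀ m (f : ℕ → Carrier) → ∑< (suc m) f ≈ ∑< m f + f m
  ∑<-snoc m f = trans (sum-init-last {m} (f ∘ toℕ))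
    (+-cong (reflexive (sum-cong-≗ {m} (cong f ∘ toℕ-inject₁))) (reflexive (cong f (toℕ-fromℕ m))))

  ∑<-truncate : ∀ {p} m {f : ℕ → Carrier} → p ≤ m → (∀ r → p ≤ r → r < m → f r ≈ 0#) →
                ∑< m f ≈ ∑< p f
  ∑<-truncate zero    z≤n _ = refl
  ∑<-truncate (suc m) {f} p≤1+m f≈0 with ℕₚ.m≤n⇒m<n∨m≡n p≤1+m
  ... | inj₂ ≡.refl    = refl
  ... | inj₁ (s≤s p≤m) = begin
    ∑< (suc m) f   ≈⟨ ∑<-snoc m f ⟩
    ∑< m f + f m   ≈⟨ +-cong (∑<-truncate m p≤m (λ r p≤r r<m → f≈0 r p≤r (ℕₚ.m<n⇒m<1+n r<m)))
                             (f≈0 m p≤m ℕₚ.≤-refl) ⟩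
    _ + 0#         ≈⟨ +-identityʳ _ ⟩
    _              ∎

  ∑<-const : ∀ m x → ∑< m (λ _ → x) ≈ nat m * x
  ∑<-const zero    x = sym (zeroˡ x)
  ∑<-const (suc m) x = begin
    x + ∑< m (λ _ → x)   ≈⟨ +-cong (sym (*-identityˡ x)) (∑<-const m x) ⟩
    1# * x + nat m * x   ≈⟨ distribʳ x 1# (nat m) ⟨
    (1# + nat m) * x     ∎

  ∑<-triangle : ∀ m (g : ℕ → Carrier) →
                ∑< m (λ a → ∑< (m ∸ suc a) g) ≈ ∑< m (λ r → nat (m ∸ suc r) * g r)
  ∑<-triangle zero    g = refl
  ∑<-triangle (suc m) g = begin
    ∑< m g + ∑< m (λ a → ∑< (m ∸ suc a) g)        ≈⟨ +-congˡ (∑<-triangle m g) ⟩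
    ∑< m g + ∑< m (λ r → nat (m ∸ suc r) * g r)   ≈⟨ ∑-distrib-+ {m} (g ∘ toℕ) _ ⟨
    ∑< m (λ r → g r + nat (m ∸ suc r) * g r)      ≈⟨ ∑<-cong m one-more ⟩
    ∑< m h                                        ≈⟨ +-identityʳ _ ⟨
    ∑< m h + 0#                                   ≈⟨ +-congˡ last-vanishes ⟨
    ∑< m h + h m                                  ≈⟨ ∑<-snoc m h ⟨
    ∑< (suc m) h                                  ∎
    where
    h : ℕ → Carrier
    h r = nat (suc m ∸ suc r) * g r
    one-more : ∀ r → r < m → g r + nat (m ∸ suc r) * g r ≈ h r
    one-more r r<m = begin
      g r + nat (m ∸ suc r) * g r        ≈⟨ +-congʳ (*-identityˡ (g r)) ⟨
      1# * g r + nat (m ∸ suc r) * g r   ≈⟨ distribʳ (g r) 1# _ ⟨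
      nat (suc (m ∸ suc r)) * g r        ≡⟨ cong (λ d → nat d * g r) (m∸n≡1+m∸[1+n] r<m) ⟨
      nat (m ∸ r) * g r                  ∎
    last-vanishes : h m ≈ 0#
    last-vanishes = trans (reflexive (cong (λ d → nat d * g m) (ℕₚ.n∸n≡0 m))) (zeroˡ (g m))

  sum-select : ∀ {m} (e g : Fin m → Carrier) j → e j ≈ 1# → (∀ l → l ≢ j → e l ≈ 0#) →
               sum (λ l → e l * g l) ≈ g j
  sum-select {suc m} e g j ej≈1 el≈0 = begin
    sum (λ l → e l * g l)                   ≈⟨ sum-remove {i = j} (λ l → e l * g l) ⟩
    e j * g j + sum (λ l → e (l′ l) * g (l′ l))
      ≈⟨ +-cong (trans (*-congʳ ej≈1) (*-identityˡ (g j)))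
                (trans (sum-cong-≋ off-j) (sum-replicate-zero m)) ⟩
    g j + 0#                                ≈⟨ +-identityʳ (g j) ⟩
    g j                                     ∎
    where
    l′ = punchIn j
    off-j : ∀ l → e (l′ l) * g (l′ l) ≈ 0#
    off-j l = trans (*-congʳ (el≈0 (l′ l) (punchInᵢ≢i j l))) (zeroˡ (g (l′ l)))

module CompanionPowers {c ℓ : Level} (R : CommutativeRing c ℓ) {k : ℕ}
                       (t : Fin k → CommutativeRing.Carrier R) where
  open CommutativeRing R
  open GenFibLuc R
  open Sums R
  open CommutativeSemigroupProperties *-commutativeSemigroup using (x∙yz≈y∙xz)
  open RingProperties ring using (x[y-z]≈xy-xz)
  open GroupProperties +-group using (ε⁻¹≈ε)
  open import Relation.Binary.Reasoning.Setoid setoid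

  tℕ : ℕ → Carrier
  tℕ r = tIx t (suc r)

  tℕ-toℕ : ∀ i → tℕ (toℕ i) ≡ t i
  tℕ-toℕ i with toℕ i ℕ.<? k
  ... | yes i<k = cong t (fromℕ<-toℕ i i<k)
  ... | no  i≮k = ⊥-elim (i≮k (toℕ<n i))

  hist-vanishes : ∀ {m j} → m < j → hist t m j ≡ 0#
  hist-vanishes {zero}  {suc j} _         = ≡.refl
  hist-vanishes {suc m} {suc j} (s≤s m<j) = hist-vanishes m<j

  hist-diagonal : ∀ m → hist t m m ≡ 1#
  hist-diagonal zero    = ≡.refl
  hist-diagonal (suc m) = hist-diagonal m

  hist-shift : ∀ m j d → hist t (m ℕ.+ d) (j ℕ.+ d) ≡ hist t m j
  hist-shift m j d rewrite ℕₚ.+-comm m d | ℕₚ.+-comm j d = shiftˡ d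
    where
    shiftˡ : ∀ d → hist t (d ℕ.+ m) (d ℕ.+ j) ≡ hist t m j
    shiftˡ zero    = ≡.refl
    shiftˡ (suc d) = shiftˡ d

  F-difference : ∀ a b → F t (+ a -ℤ + b) ≡ hist t a b
  F-difference a b rewrite m-n≡m⊖n a b = F-⊖ a b
    where
    F-⊖ : ∀ a b → F t (a ⊖ b) ≡ hist t a b
    F-⊖ zero    zero    = ≡.refl
    F-⊖ (suc a) zero    = ≡.refl
    F-⊖ zero    (suc b) = ≡.refl
    F-⊖ (suc a) (suc b) rewrite [1+m]⊖[1+n]≡m⊖n a b = F-⊖ a b

  hist-recurrence : ∀ {x M} → x ≤ M → hist t (suc M) x ≈ ∑< k (λ l → tℕ l * hist t M (x ℕ.+ l))
  hist-recurrence {x} {M} x≤M with M ∸ x | ℕₚ.m+[n∸m]≡n x≤M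
  ... | d | ≡.refl = shifted x
    where
    shifted : ∀ x → hist t (suc (x ℕ.+ d)) x ≈ ∑< k (λ l → tℕ l * hist t (x ℕ.+ d) (x ℕ.+ l))
    shifted zero    = begin
      sumFin k (λ i → t i * hist t d (toℕ i))   ≡⟨ sumFin≡sum k _ ⟩
      sum (λ i → t i * hist t d (toℕ i))
        ≈⟨ sum-cong-≋ (λ i → *-congʳ (reflexive (≡.sym (tℕ-toℕ i)))) ⟩
      ∑< k (λ l → tℕ l * hist t d l)            ∎
    shifted (suc x) = shifted x

  x-0#≈x : ∀ x → x - 0# ≈ x
  x-0#≈x x = trans (+-congˡ ε⁻¹≈ε) (+-identityʳ x)

  Λ : ℕ → (ℕ → Carrier) → Carrier
  Λ b u = u b - ∑< (k ∸ suc b) (λ r → tℕ r * u (suc (b ℕ.+ r)))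

  Λ-cong : ∀ {b} {u v : ℕ → Carrier} → b < k → (∀ x → b ≤ x → x < k → u x ≈ v x) →
           Λ b u ≈ Λ b v
  Λ-cong {b} b<k u≈v = +-cong (u≈v b ℕₚ.≤-refl b<k) (-‿cong (∑<-cong (k ∸ suc b) (λ r r<k∸1+b →
    *-congˡ {tℕ r} (u≈v (suc (b ℕ.+ r)) (ℕₚ.m≤n⇒m≤1+n (ℕₚ.m≤m+n b r))
                                        (m<n∸o⇒o+m<n r<k∸1+b)))))

  Λ-linear : ∀ b m (w : ℕ → Carrier) (u : ℕ → ℕ → Carrier) →
             ∑< m (λ l → w l * Λ b (u l)) ≈ Λ b (λ x → ∑< m (λ l → w l * u l x))
  Λ-linear b m w u = begin
    ∑< m (λ l → w l * Λ b (u l))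
      ≈⟨ ∑<-cong m (λ l _ → x[y-z]≈xy-xz (w l) (u l b) (C l)) ⟩
    ∑< m (λ l → w l * u l b - w l * C l)
      ≈⟨ ∑<-distrib-- m (λ l → w l * u l b) (λ l → w l * C l) ⟩
    ∑< m (λ l → w l * u l b) - ∑< m (λ l → w l * C l)
      ≈⟨ +-congˡ (-‿cong regroup) ⟩
    Λ b (λ x → ∑< m (λ l → w l * u l x))
      ∎
    where
    p = k ∸ suc b
    C : ℕ → Carrier
    C l = ∑< p (λ r → tℕ r * u l (suc (b ℕ.+ r)))
    regroup : ∑< m (λ l → w l * C l) ≈ ∑< p (λ r → tℕ r * ∑< m (λ l → w l * u l (suc (b ℕ.+ r))))
    regroup = begin
      ∑< m (λ l → w l * C l)
        ≈⟨ ∑<-cong m (λ l _ → *-distribˡ-sum {p} (w l) (λ i → tℕ (toℕ i) * u′ l (toℕ i))) ⟩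
      ∑< m (λ l → ∑< p (λ r → w l * (tℕ r * u′ l r)))
        ≈⟨ ∑-comm {m} {p} (λ i j → w (toℕ i) * (tℕ (toℕ j) * u′ (toℕ i) (toℕ j))) ⟩
      ∑< p (λ r → ∑< m (λ l → w l * (tℕ r * u′ l r)))
        ≈⟨ ∑<-cong p (λ r _ → ∑<-cong m (λ l _ → x∙yz≈y∙xz (w l) (tℕ r) (u′ l r))) ⟩
      ∑< p (λ r → ∑< m (λ l → tℕ r * (w l * u′ l r)))
        ≈⟨ ∑<-cong p (λ r _ → *-distribˡ-sum {m} (tℕ r) (λ i → w (toℕ i) * u′ (toℕ i) r)) ⟨
      ∑< p (λ r → tℕ r * ∑< m (λ l → w l * u′ l r))
        ∎
      where
      u′ : ℕ → ℕ → Carrier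
      u′ l r = u l (suc (b ℕ.+ r))

  Λ-hist-upper : ∀ {a b} → a ≤ b → Λ b (hist t a) ≈ hist t a b
  Λ-hist-upper {a} {b} a≤b = trans (+-congˡ (-‿cong correction-vanishes)) (x-0#≈x (hist t a b))
    where
    correction-vanishes : ∑< (k ∸ suc b) (λ r → tℕ r * hist t a (suc (b ℕ.+ r))) ≈ 0#
    correction-vanishes = ∑<-zero (k ∸ suc b) (λ r _ →
      trans (*-congˡ (reflexive (hist-vanishes (s≤s (ℕₚ.≤-trans a≤b (ℕₚ.m≤m+n b r))))))
            (zeroʳ (tℕ r)))

  Λ-hist-lower : ∀ {a b} → b < a → a < k → Λ b (hist t a) ≈ 0#
  Λ-hist-lower {suc M} {b} (s≤s b≤M) 1+M<k = begin
    hist t (suc M) b - ∑< p f   ≈⟨ +-congʳ (hist-recurrence b≤M) ⟩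
    ∑< k f - ∑< p f             ≈⟨ +-congʳ (∑<-truncate k (ℕₚ.m∸n≤m k (suc b)) f-vanishes) ⟩
    ∑< p f - ∑< p f             ≈⟨ -‿inverseʳ (∑< p f) ⟩
    0#                          ∎
    where
    p = k ∸ suc b
    f : ℕ → Carrier
    f l = tℕ l * hist t M (b ℕ.+ l)
    f-vanishes : ∀ l → p ≤ l → l < k → f l ≈ 0#
    f-vanishes l p≤l _ = trans (*-congˡ (reflexive (hist-vanishes M<b+l))) (zeroʳ (tℕ l))
      where
      M<b+l : M < b ℕ.+ l
      M<b+l = ℕₚ.≤-pred (ℕₚ.≤-trans 1+M<k
                (ℕₚ.≤-trans (ℕₚ.m≤n+m∸n k (suc b)) (ℕₚ.+-monoʳ-≤ (suc b) p≤l)))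

  idMat≈Λ-hist : ∀ (i j : Fin k) → idMat i j ≈ Λ (toℕ j) (hist t (toℕ i))
  idMat≈Λ-hist i j with toℕ i ℕₚ.≟ toℕ j
  ... | yes i≡j = sym (begin
    Λ (toℕ j) (hist t (toℕ i))   ≈⟨ Λ-hist-upper (ℕₚ.≤-reflexive i≡j) ⟩
    hist t (toℕ i) (toℕ j)       ≡⟨ cong (λ a → hist t a (toℕ j)) i≡j ⟩
    hist t (toℕ j) (toℕ j)       ≡⟨ hist-diagonal (toℕ j) ⟩
    1#                           ∎)
  ... | no  i≢j with ℕₚ.<-cmp (toℕ i) (toℕ j)
  ...   | tri< i<j _ _ = sym (trans (Λ-hist-upper (ℕₚ.<⇒≤ i<j)) (reflexive (hist-vanishes i<j)))
  ...   | tri≈ _ i≡j _ = ⊥-elim (i≢j i≡j)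
  ...   | tri> _ _ j<i = sym (Λ-hist-lower j<i (toℕ<n i))

  companion-superdiagonal : ∀ {i l} → suc (toℕ i) ≢ k → toℕ l ≡ suc (toℕ i) → companion t i l ≡ 1#
  companion-superdiagonal {i} {l} ≢k l≡1+i with suc (toℕ i) ℕₚ.≟ k
  ... | yes ≡k = ⊥-elim (≢k ≡k)
  ... | no  _ with toℕ l ℕₚ.≟ suc (toℕ i)
  ...   | yes _     = ≡.refl
  ...   | no  l≢1+i = ⊥-elim (l≢1+i l≡1+i)

  companion-offdiagonal : ∀ {i l} → suc (toℕ i) ≢ k → toℕ l ≢ suc (toℕ i) → companion t i l ≡ 0#
  companion-offdiagonal {i} {l} ≢k l≢1+i with suc (toℕ i) ℕₚ.≟ k
  ... | yes ≡k = ⊥-elim (≢k ≡k)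
  ... | no  _ with toℕ l ℕₚ.≟ suc (toℕ i)
  ...   | yes l≡1+i = ⊥-elim (l≢1+i l≡1+i)
  ...   | no  _     = ≡.refl

  companion-last : ∀ {i} l → suc (toℕ i) ≡ k → companion t i l ≡ t (opposite l)
  companion-last {i} l ≡k with suc (toℕ i) ℕₚ.≟ k
  ... | yes _  = ≡.refl
  ... | no  ≢k = ⊥-elim (≢k ≡k)

  companion-times-nonlast : ∀ {i} (v : ℕ → Carrier) → suc (toℕ i) ≢ k →
                            sum (λ l → companion t i l * v (toℕ l)) ≈ v (suc (toℕ i))
  companion-times-nonlast {i} v ≢k = begin
    sum (λ l → companion t i l * v (toℕ l))
      ≈⟨ sum-select (companion t i) (v ∘ toℕ) j (reflexive (companion-superdiagonal ≢k toℕj≡1+i))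
                    (λ l l≢j → reflexive (companion-offdiagonal ≢k (l≢j ∘ toℕ-injective ∘ into-j))) ⟩
    v (toℕ j)         ≡⟨ cong v toℕj≡1+i ⟩
    v (suc (toℕ i))   ∎
    where
    1+i<k = ℕₚ.≤∧≢⇒< (toℕ<n i) ≢k
    j = fromℕ< 1+i<k
    toℕj≡1+i : toℕ j ≡ suc (toℕ i)
    toℕj≡1+i = toℕ-fromℕ< 1+i<k
    into-j : ∀ {l} → toℕ l ≡ suc (toℕ i) → toℕ l ≡ toℕ j
    into-j l≡1+i = ≡.trans l≡1+i (≡.sym toℕj≡1+i)

  companion-times-last : ∀ {i} (v : ℕ → Carrier) → suc (toℕ i) ≡ k →
                         sum (λ l → companion t i l * v (toℕ l)) ≈ ∑< k (λ l → tℕ l * v (k ∸ suc l))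
  companion-times-last {i} v ≡k = begin
    sum (λ l → companion t i l * v (toℕ l))
      ≈⟨ sum-cong-≋ (λ l → *-congʳ (reflexive (companion-last l ≡k))) ⟩
    sum (λ l → t (opposite l) * v (toℕ l))
      ≈⟨ sum-permute (λ l → t (opposite l) * v (toℕ l)) Perm.reverse ⟩
    sum (λ l → t (opposite (opposite l)) * v (toℕ (opposite l)))
      ≈⟨ sum-cong-≋ (λ l → *-cong
           (reflexive (≡.trans (cong t (opposite-involutive l)) (≡.sym (tℕ-toℕ l))))
           (reflexive (cong v (opposite-prop l)))) ⟩
    ∑< k (λ l → tℕ l * v (k ∸ suc l))
      ∎

  Λ-hist-last-row : ∀ n {a b} → suc a ≡ k → b < k →
    ∑< k (λ l → tℕ l * Λ b (hist t (n ℕ.+ (k ∸ suc l)))) ≈ Λ b (hist t (suc (n ℕ.+ a)))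
  Λ-hist-last-row n {a} {b} 1+a≡k b<k = begin
    ∑< k (λ l → tℕ l * Λ b (hist t (n ℕ.+ (k ∸ suc l))))
      ≈⟨ ∑<-cong k (λ l l<k → *-congˡ {tℕ l} (Λ-cong b<k (λ x _ _ → reflexive (shift l x l<k)))) ⟩
    ∑< k (λ l → tℕ l * Λ b (λ x → hist t (n ℕ.+ a) (x ℕ.+ l)))
      ≈⟨ Λ-linear b k tℕ (λ l x → hist t (n ℕ.+ a) (x ℕ.+ l)) ⟩
    Λ b (λ x → ∑< k (λ l → tℕ l * hist t (n ℕ.+ a) (x ℕ.+ l)))
      ≈⟨ Λ-cong b<k (λ x _ x<k → sym (hist-recurrence (ℕₚ.m≤n⇒m≤o+n n (≤a x<k)))) ⟩
    Λ b (hist t (suc (n ℕ.+ a)))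
      ∎
    where
    ≤a : ∀ {l} → l < k → l ≤ a
    ≤a l<k = ℕₚ.≤-pred (≡.subst (_ <_) (≡.sym 1+a≡k) l<k)
    shift : ∀ l x → l < k → hist t (n ℕ.+ (k ∸ suc l)) x ≡ hist t (n ℕ.+ a) (x ℕ.+ l)
    shift l x l<k = ≡.trans (≡.sym (hist-shift (n ℕ.+ (k ∸ suc l)) x l))
                            (cong (λ m → hist t m (x ℕ.+ l)) n+[k∸1+l]+l≡n+a)
      where
      n+[k∸1+l]+l≡n+a : n ℕ.+ (k ∸ suc l) ℕ.+ l ≡ n ℕ.+ a
      n+[k∸1+l]+l≡n+a = ≡.trans (ℕₚ.+-assoc n (k ∸ suc l) l) (cong (n ℕ.+_)
        (≡.trans (cong (λ m → m ∸ suc l ℕ.+ l) (≡.sym 1+a≡k)) (ℕₚ.m∸n+n≡m (≤a l<k))))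

  companion-times-Λ-hist : ∀ n (i j : Fin k) →
    sum (λ l → companion t i l * Λ (toℕ j) (hist t (n ℕ.+ toℕ l)))
      ≈ Λ (toℕ j) (hist t (suc (n ℕ.+ toℕ i)))
  companion-times-Λ-hist n i j = by-row (suc (toℕ i) ℕₚ.≟ k)
    where
    v : ℕ → Carrier
    v x = Λ (toℕ j) (hist t (n ℕ.+ x))
    by-row : Dec (suc (toℕ i) ≡ k) →
             sum (λ l → companion t i l * v (toℕ l)) ≈ Λ (toℕ j) (hist t (suc (n ℕ.+ toℕ i)))
    by-row (no  ≢k) = trans (companion-times-nonlast v ≢k)
                            (reflexive (cong (λ m → Λ (toℕ j) (hist t m)) (ℕₚ.+-suc n (toℕ i))))
    by-row (yes ≡k) = trans (companion-times-last v ≡k) (Λ-hist-last-row n ≡k (toℕ<n j))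

  companion-pow-entry : ∀ n (i j : Fin k) → (companion t ^M n) i j ≈ Λ (toℕ j) (hist t (n ℕ.+ toℕ i))
  companion-pow-entry zero    i j = idMat≈Λ-hist i j
  companion-pow-entry (suc n) i j = begin
    sumFin k (λ l → companion t i l * (companion t ^M n) l j)
      ≡⟨ sumFin≡sum k _ ⟩
    sum (λ l → companion t i l * (companion t ^M n) l j)
      ≈⟨ sum-cong-≋ (λ l → *-congˡ (companion-pow-entry n l j)) ⟩
    sum (λ l → companion t i l * Λ (toℕ j) (hist t (n ℕ.+ toℕ l)))
      ≈⟨ companion-times-Λ-hist n i j ⟩
    Λ (toℕ j) (hist t (suc n ℕ.+ toℕ i))
      ∎

  Λ-hist-diagonal : ∀ n a →
    Λ a (hist t (n ℕ.+ a)) ≈ hist t n 0 - ∑< (k ∸ suc a) (λ r → tℕ r * hist t n (suc r))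
  Λ-hist-diagonal n a = +-cong (reflexive (hist-shift n 0 a))
    (-‿cong (∑<-cong (k ∸ suc a) (λ r _ → *-congˡ {tℕ r} (reflexive (unshift r)))))
    where
    unshift : ∀ r → hist t (n ℕ.+ a) (suc (a ℕ.+ r)) ≡ hist t n (suc r)
    unshift r = ≡.trans (cong (λ x → hist t (n ℕ.+ a) (suc x)) (ℕₚ.+-comm a r)) (hist-shift n (suc r) a)

  lucas-fibonacci : ∀ n →
    G t n ≈ nat k * hist t n 0 - ∑< (k ∸ 1) (λ r → nat (k ∸ suc r) * (tℕ r * hist t n (suc r)))
  lucas-fibonacci n = begin
    sumFin k (λ i → (companion t ^M n) i i)
      ≡⟨ sumFin≡sum k _ ⟩
    sum (λ i → (companion t ^M n) i i)
      ≈⟨ sum-cong-≋ (λ i → companion-pow-entry n i i) ⟩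
    ∑< k (λ a → Λ a (hist t (n ℕ.+ a)))
      ≈⟨ ∑<-cong k (λ a _ → Λ-hist-diagonal n a) ⟩
    ∑< k (λ a → hist t n 0 - ∑< (k ∸ suc a) g)
      ≈⟨ ∑<-distrib-- k (λ _ → hist t n 0) (λ a → ∑< (k ∸ suc a) g) ⟩
    ∑< k (λ _ → hist t n 0) - ∑< k (λ a → ∑< (k ∸ suc a) g)
      ≈⟨ +-cong (∑<-const k (hist t n 0)) (-‿cong (∑<-triangle k g)) ⟩
    nat k * hist t n 0 - ∑< k h
      ≈⟨ +-congˡ (-‿cong (∑<-truncate k (ℕₚ.m∸n≤m k 1) h-vanishes)) ⟩
    nat k * hist t n 0 - ∑< (k ∸ 1) h
      ∎
    where
    g h : ℕ → Carrier
    g r = tℕ r * hist t n (suc r)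
    h r = nat (k ∸ suc r) * g r
    h-vanishes : ∀ r → k ∸ 1 ≤ r → r < k → h r ≈ 0#
    h-vanishes r k∸1≤r _ =
      trans (*-congʳ (reflexive (cong nat (ℕₚ.m≤n⇒m∸n≡0 k≤1+r)))) (zeroˡ (g r))
      where
      k≤1+r : k ≤ suc r
      k≤1+r = ℕₚ.≤-trans (ℕₚ.m≤n+m∸n k 1) (s≤s k∸1≤r)

-- The identity holds for every k.
theorem2p7 : ∀ {c ℓ : Level} (R : CommutativeRing c ℓ) (k : ℕ) → 2 ≤ k →
    (t : Fin k → CommutativeRing.Carrier R) (n : ℕ) →
    let open CommutativeRing R
        open GenFibLuc R
    in G t n ≈ nat k * F t (+ n)
               - sumRange 2 k (λ j → nat (suc k ∸ j) * tIx t (j ∸ 1) * F t (+ suc n -ℤ + j))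
theorem2p7 R k _ t n = begin
  G t n
    ≈⟨ lucas-fibonacci n ⟩
  nat k * F t (+ n) - ∑< (k ∸ 1) (λ r → nat (k ∸ suc r) * (tℕ r * hist t n (suc r)))
    ≈⟨ +-congˡ (-‿cong (∑<-cong (k ∸ 1) (λ r _ → reindex r))) ⟩
  nat k * F t (+ n) - ∑< (k ∸ 1) (λ r → summand (2 ℕ.+ r))
    ≈⟨ +-congˡ (-‿cong (sumFrom≈∑< 2 (k ∸ 1) summand)) ⟨
  nat k * F t (+ n) - sumRange 2 k summand
    ∎
  where
  open CommutativeRing R
  open GenFibLuc R
  open Sums R
  open CompanionPowers R t
  open import Relation.Binary.Reasoning.Setoid setoid
  summand : ℕ → Carrier
  summand j = nat (suc k ∸ j) * tIx t (j ∸ 1) * F t (+ suc n -ℤ + j)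
  reindex : ∀ r → nat (k ∸ suc r) * (tℕ r * hist t n (suc r)) ≈ summand (2 ℕ.+ r)
  reindex r = begin
    nat (k ∸ suc r) * (tℕ r * hist t n (suc r))
      ≡⟨ cong (λ x → nat (k ∸ suc r) * (tℕ r * x)) (F-difference (suc n) (2 ℕ.+ r)) ⟨
    nat (k ∸ suc r) * (tℕ r * F t (+ suc n -ℤ + (2 ℕ.+ r)))
      ≈⟨ *-assoc (nat (k ∸ suc r)) (tℕ r) _ ⟨
    summand (2 ℕ.+ r)
      ∎
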